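{- Let $<$ be a relation on a type $A$. If $<$ is well-founded, then so is $<^L$ on $\mathsf{List}\,A$.
   Context: Homotopy type theory setting; relations are arbitrary type families. The relation $<^L$ on $\mathsf{List}\,A$ is inductively generated by: if every element $y$ of $k:\mathsf{List}\,A$ satisfies $y<x$, then $(l_1::k::l_3)<^L(l_1::[x]::l_3)$ for all lists $l_1,l_3$. $\mathsf{acc}^<$ is inductively generated by $\mathsf{step}:(\Pi x.(x<a)\to\mathsf{acc}^<(x))\to\mathsf{acc}^<(a)$, and $<$ is well-founded if every element is accessible. -}

module Defs where

open import Level using (Level; _⊔_)
open import Data.List using (List; [_]; _++_)
open import Data.List.Membership.Propositional using (_∈_)

data Acc {a r : Level} {A : Set a} (_<_ : A → A → Set r) (x : A) : Set (a ⊔ r) where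
  step : (∀ y → y < x → Acc _<_ y) → Acc _<_ x

WellFounded : {a r : Level} {A : Set a} (_<_ : A → A → Set r) → Set (a ⊔ r)
WellFounded {A = A} _<_ = ∀ (x : A) → Acc _<_ x

data _<ᴸ_ {a r : Level} {A : Set a} {_<_ : A → A → Set r} : List A → List A → Set (a ⊔ r) where
  mk : (l₁ k l₃ : List A) (x : A) →
       (∀ y → y ∈ k → y < x) →
       _<ᴸ_ {_<_ = _<_} (l₁ ++ k ++ l₃) (l₁ ++ [ x ] ++ l₃)

ListRel : {a r : Level} {A : Set a} (_<_ : A → A → Set r) → List A → List A → Set (a ⊔ r)
ListRel _<_ = _<ᴸ_ {_<_ = _<_}

module Submission where

-- The proof rests on three closure facts about the
-- <ᴸ-accessible lists:
--   * []  is accessible (it has no predecessors);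
--   * if l and m are accessible, so is l ++ m: a step below l ++ m happens
--     entirely inside l or entirely inside m (`++-predecessor`), so we argue
--     by lexicographic induction on the two accessibility proofs;
--   * if x is <-accessible, then [ x ] is <ᴸ-accessible: every predecessor
--     of [ x ] is a list of elements below x, which are accessible by the
--     induction hypothesis and hence, by the previous two facts, so is
--     the list (`acc-all`).
-- Every list is then accessible, being built from accessible singletons.

open import Defs
open import Level using (Level; _⊔_)
open import Data.Empty using (⊥; ⊥-elim)
open import Data.List using (List; []; _∷_; [_]; _++_)
open import Data.List.Properties using (++-assoc; ++-identityʳ; ∷-injective)
open import Data.List.Membership.Propositional using (_∈_)
open import Data.List.Relation.Unary.All using (All; []; _∷_; tabulate)
open import Data.Product using (Σ-syntax; _×_; _,_)
open import Data.Sum using (_⊎_; inj₁; inj₂)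
open import Relation.Binary.PropositionalEquality
  using (_≡_; refl; sym; cong; subst; module ≡-Reasoning)

split-at-entry : ∀ {a} {A : Set a} (l m l₁ l₃ : List A) (x : A) →
  l₁ ++ x ∷ l₃ ≡ l ++ m →
  (Σ[ l′ ∈ List A ] l ≡ l₁ ++ x ∷ l′ × l₃ ≡ l′ ++ m) ⊎
  (Σ[ m₁ ∈ List A ] m ≡ m₁ ++ x ∷ l₃ × l₁ ≡ l ++ m₁)
split-at-entry []      m l₁       l₃ x eq = inj₂ (l₁ , sym eq , refl)
split-at-entry (b ∷ l) m []       l₃ x eq with ∷-injective eq
... | refl , refl = inj₁ (l , refl , refl)
split-at-entry (b ∷ l) m (c ∷ l₁) l₃ x eq with ∷-injective eq
... | refl , eq′ with split-at-entry l m l₁ l₃ x eq′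
...   | inj₁ (l′ , p , q) = inj₁ (l′ , cong (c ∷_) p , q)
...   | inj₂ (m₁ , p , q) = inj₂ (m₁ , p , cong (c ∷_) q)

module _ {a r : Level} {A : Set a} (_<_ : A → A → Set r) where

  private
    _<ᴸ′_ : List A → List A → Set (a ⊔ r)
    _<ᴸ′_ = ListRel _<_

    AccL : List A → Set (a ⊔ r)
    AccL = Acc _<ᴸ′_

  no-predecessor-of-[] : ∀ {z w} → z <ᴸ′ w → w ≡ [] → ⊥
  no-predecessor-of-[] (mk []      k l₃ x hk) ()
  no-predecessor-of-[] (mk (_ ∷ _) k l₃ x hk) ()

  acc-[] : AccL []
  acc-[] = step λ z z<[] → ⊥-elim (no-predecessor-of-[] z<[] refl)

  ++-predecessor : ∀ l m {z w} → z <ᴸ′ w → w ≡ l ++ m →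
    (Σ[ l₀ ∈ List A ] l₀ <ᴸ′ l × z ≡ l₀ ++ m) ⊎
    (Σ[ m₀ ∈ List A ] m₀ <ᴸ′ m × z ≡ l ++ m₀)
  ++-predecessor l m (mk l₁ k l₃ x hk) eq with split-at-entry l m l₁ l₃ x eq
  ... | inj₁ (l′ , refl , refl) = inj₁ (l₁ ++ k ++ l′ , mk l₁ k l′ x hk , reassociate)
    where
    open ≡-Reasoning
    reassociate : l₁ ++ k ++ l′ ++ m ≡ (l₁ ++ k ++ l′) ++ m
    reassociate = begin
      l₁ ++ k ++ l′ ++ m     ≡⟨ cong (l₁ ++_) (sym (++-assoc k l′ m)) ⟩
      l₁ ++ (k ++ l′) ++ m   ≡⟨ sym (++-assoc l₁ (k ++ l′) m) ⟩
      (l₁ ++ k ++ l′) ++ m   ∎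
  ... | inj₂ (m₁ , refl , refl) = inj₂ (m₁ ++ k ++ l₃ , mk m₁ k l₃ x hk , ++-assoc l m₁ (k ++ l₃))

  acc-++ : ∀ {l m} → AccL l → AccL m → AccL (l ++ m)
  acc-++ {l} {m} acc-l@(step below-l) acc-m@(step below-m) = step λ z z<l++m →
    accessible z (++-predecessor l m z<l++m refl)
    where
    accessible : ∀ z →
      (Σ[ l₀ ∈ List A ] l₀ <ᴸ′ l × z ≡ l₀ ++ m) ⊎
      (Σ[ m₀ ∈ List A ] m₀ <ᴸ′ m × z ≡ l ++ m₀) → AccL z
    accessible _ (inj₁ (l₀ , l₀<l , refl)) = acc-++ (below-l l₀ l₀<l) acc-m
    accessible _ (inj₂ (m₀ , m₀<m , refl)) = acc-++ acc-l (below-m m₀ m₀<m)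

  acc-all : ∀ {k} → All (λ y → AccL [ y ]) k → AccL k
  acc-all []               = acc-[]
  acc-all (acc-y ∷ acc-ys) = acc-++ acc-y (acc-all acc-ys)

  singleton-predecessor : ∀ {x z w} → z <ᴸ′ w → w ≡ [ x ] → ∀ {y} → y ∈ z → y < x
  singleton-predecessor (mk [] k [] _ hk) refl {y} y∈z =
    hk y (subst (y ∈_) (++-identityʳ k) y∈z)
  singleton-predecessor (mk []          k (_ ∷ _) _ hk) ()
  singleton-predecessor (mk (_ ∷ [])    k l₃      _ hk) ()
  singleton-predecessor (mk (_ ∷ _ ∷ _) k l₃      _ hk) ()

  acc-[_] : ∀ {x} → Acc _<_ x → AccL [ x ]
  acc-[ step below-x ] = step λ z z<[x] →
    acc-all (tabulate λ y∈z → acc-[ below-x _ (singleton-predecessor z<[x] refl y∈z) ])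

lemma5p5 : {a r : Level} {A : Set a} (_<_ : A → A → Set r) →
           WellFounded _<_ → WellFounded (ListRel _<_)
lemma5p5 _<_ wf l = acc-all _<_ (tabulate λ {y} _ → acc-[_] _<_ (wf y))
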